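{- Let $G$ be a graph and $T$ be a subset of $V(G)$. If $G$ is $3$-connected and $|T|\geq 3$, then the graft $(G,T)$ has a minor isomorphic to $\Delta_2$ or $\Delta_3$.
   Context: Graphs are finite and may have loops and parallel edges. A graph is $3$-connected if it has more than $3$ vertices and remains connected after deleting any set of fewer than $3$ vertices. A graft is a pair $(G,T)$ of a graph $G$ and $T\subseteq V(G)$. Graft operations: deleting an edge $e$ gives $(G\setminus e,T)$; deleting an isolated vertex $v$ gives $(G\setminus v,T-\{v\})$; contracting an edge $e=uv$ gives $(G/e,T')$ where, with $e^*$ the vertex of $G/e$ formed from the ends of $e$, $T'=(T-\{u,v\})\cup\{e^*\}$ if $|T\cap\{u,v\}|=1$ and $T'=T-\{u,v\}$ otherwise (if $e$ is a loop, contraction equals deletion). A minor of a graft is one obtained by a sequence of these deletions and contractions. Grafts $(G,T)$, $(G',T')$ are isomorphic if some graph isomorphism $G\to G'$ maps $T$ onto $T'$. $\Delta_2=(K_{1,3},V(K_{1,3}))$ and $\Delta_3=(K_{1,3},S)$ where $S$ is the set of the three degree-$1$ vertices of $K_{1,3}$. -}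

module Defs where

open import Data.Nat using (ℕ; zero; suc; _<_)
open import Data.Bool using (Bool; true; false; _xor_; if_then_else_)
open import Data.Fin using (Fin; zero; suc; punchIn; punchOut; _≟_)
open import Data.Fin.Subset using (Subset; _∈_; _∉_; ∣_∣; ⊤; ∁; ⁅_⁆)
open import Data.Vec using (Vec; lookup; removeAt; _[_]≔_)
open import Data.Product using (Σ; ∃; _×_; _,_; proj₁; proj₂)
open import Data.Sum using (_⊎_; inj₁; inj₂)
open import Relation.Nullary using (¬_; yes; no)
open import Relation.Binary.PropositionalEquality using (_≡_; _≢_; refl; sym)
open import Relation.Binary.Construct.Closure.ReflexiveTransitive using (Star)
open import Function.Bundles using (_↔_; Inverse)

-- A graft: a finite graph (loops and parallel edges allowed) with vertex set
-- Fin nV, edge set Fin nE, each edge having an (unordered) pair of ends,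
-- recorded as an ordered pair; together with T ⊆ V(G).
record Graft : Set where
  constructor graft
  field
    nV    : ℕ
    nE    : ℕ
    ends  : Fin nE → Fin nV × Fin nV
    T     : Subset nV
open Graft public

AdjOutside : (G : Graft) → Subset (nV G) → Fin (nV G) → Fin (nV G) → Set
AdjOutside G X x y =
  x ∉ X × y ∉ X × ∃ λ e → (ends G e ≡ (x , y)) ⊎ (ends G e ≡ (y , x))

ConnectedAfterDeleting : (G : Graft) → Subset (nV G) → Set
ConnectedAfterDeleting G X =
  ∀ x y → x ∉ X → y ∉ X → Star (AdjOutside G X) x y

ThreeConnected : Graft → Set
ThreeConnected G =
  3 < nV G × (∀ (X : Subset (nV G)) → ∣ X ∣ < 3 → ConnectedAfterDeleting G X)

-- vertex map of contracting the non-loop edge with ends u ≢ v: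
-- v is identified with u, then v is removed from the indexing.
redirect : ∀ {n} → Fin (suc n) → Fin (suc n) → Fin (suc n) → Fin (suc n)
redirect u v x with x ≟ v
... | yes _ = u
... | no  _ = x

redirect-≢ : ∀ {n} (u v : Fin (suc n)) → u ≢ v → ∀ x → v ≢ redirect u v x
redirect-≢ u v u≢v x with x ≟ v
... | yes _ = λ eq → u≢v (sym eq)
... | no x≢v = λ eq → x≢v (sym eq)

merge : ∀ {n} (u v : Fin (suc n)) → u ≢ v → Fin (suc n) → Fin n
merge u v u≢v x = punchOut (redirect-≢ u v u≢v x)

mergePair : ∀ {n} (u v : Fin (suc n)) → u ≢ v →
            Fin (suc n) × Fin (suc n) → Fin n × Fin n
mergePair u v u≢v (a , b) = merge u v u≢v a , merge u v u≢v b

-- new terminal set: the merged vertex e* (position of u) is in T' iff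
-- exactly one of u, v is in T; other vertices unchanged.
contractT : ∀ {n} → Subset (suc n) → Fin (suc n) → Fin (suc n) → Subset n
contractT T u v = removeAt (T [ u ]≔ (lookup T u xor lookup T v)) v

deleteVertexEnds : ∀ {n m} (ends : Fin m → Fin (suc n) × Fin (suc n)) (v : Fin (suc n)) →
  (∀ e → (v ≢ proj₁ (ends e)) × (v ≢ proj₂ (ends e))) → Fin m → Fin n × Fin n
deleteVertexEnds ends v iso e = punchOut (proj₁ (iso e)) , punchOut (proj₂ (iso e))

data Step : Graft → Graft → Set where
  deleteEdge : ∀ {n m} (ends : Fin (suc m) → Fin n × Fin n) (T : Subset n)
    (e : Fin (suc m)) →
    Step (graft n (suc m) ends T) (graft n m (λ i → ends (punchIn e i)) T)
  deleteVertex : ∀ {n m} (ends : Fin m → Fin (suc n) × Fin (suc n)) (T : Subset (suc n))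
    (v : Fin (suc n)) (iso : ∀ e → (v ≢ proj₁ (ends e)) × (v ≢ proj₂ (ends e))) →
    Step (graft (suc n) m ends T) (graft n m (deleteVertexEnds ends v iso) (removeAt T v))
  -- contracting a non-loop edge e (contracting a loop equals deleting it)
  contractEdge : ∀ {n m} (ends : Fin (suc m) → Fin (suc n) × Fin (suc n))
    (T : Subset (suc n)) (e : Fin (suc m))
    (nl : proj₁ (ends e) ≢ proj₂ (ends e)) →
    Step (graft (suc n) (suc m) ends T)
         (graft n m (λ i → mergePair (proj₁ (ends e)) (proj₂ (ends e)) nl (ends (punchIn e i)))
                (contractT T (proj₁ (ends e)) (proj₂ (ends e))))

Minor : Graft → Graft → Set
Minor G H = Star Step G H

record GraftIso (G H : Graft) : Set where
  field
    vmap  : Fin (nV G) ↔ Fin (nV H)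
    emap  : Fin (nE G) ↔ Fin (nE H)
    ends-pres : ∀ e →
      let f = Inverse.to vmap
          a = proj₁ (ends G e)
          b = proj₂ (ends G e)
      in (ends H (Inverse.to emap e) ≡ (f a , f b)) ⊎
         (ends H (Inverse.to emap e) ≡ (f b , f a))
    T-pres : ∀ x → (x ∈ T G → Inverse.to vmap x ∈ T H) ×
                   (Inverse.to vmap x ∈ T H → x ∈ T G)

K13ends : Fin 3 → Fin 4 × Fin 4
K13ends i = zero , suc i

Δ₂ : Graft
Δ₂ = graft 4 3 K13ends ⊤

Δ₃ : Graft
Δ₃ = graft 4 3 K13ends (∁ ⁅ zero ⁆)

{-# OPTIONS --safe #-}

-- Pick three terminals t₀, t₁, t₂ and a fourth vertex w. Deleting two of the
-- terminals leaves G connected, so w reaches the third one; the part of such a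
-- walk before it first meets that terminal avoids all three. The union C of the
-- three walks is connected, avoids the tᵢ, and each tᵢ has an edge into C.
-- This configuration survives deleting an edge that is neither inside C nor a
-- chosen edge from some tᵢ, deleting a vertex outside C ∪ {t₀, t₁, t₂} (which
-- is then isolated), and contracting a non-loop edge inside C. When no such
-- operation applies, C is a single vertex r joined to each tᵢ by exactly one
-- edge, and nothing else remains: this is Δ₂ or Δ₃ according as r ∈ T.

module Submission where

open import Defs
open import Data.Nat using (ℕ; zero; suc; _≤_; _<_; z≤n; s≤s; _+_)
open import Data.Nat.Properties using (≤-trans; n≤1+n; n<1+n; <⇒≱; +-suc; +-monoʳ-≤; +-monoʳ-<; +-monoˡ-<)
open import Data.Nat.Induction using (<-wellFounded)
open import Data.Bool using (true; false; _xor_)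
open import Data.Fin using (Fin; zero; suc; punchIn; punchOut; _≟_)
open import Data.Fin.Properties
  using (punchIn-punchOut; punchOut-punchIn; punchOut-cong; punchInᵢ≢i; suc-injective; 0≢1+n; any?; all?; ¬∀⟶∃¬; injective⇒≤)
open import Data.Fin.Subset using (Subset; _∈_; _∉_; ∣_∣; _∪_; ⊤; ∁; ⁅_⁆)
open import Data.Fin.Subset.Properties
  using (_∈?_; ∈⊤; ∣⁅x⁆∣≡1; x∈⁅x⁆; x∈⁅y⁆⇒x≡y; x∈p∪q⁺; x∈p∪q⁻; x∉p⇒x∈∁p; x∈∁p⇒x∉p)
open import Data.Vec using (Vec; []; _∷_; lookup; removeAt; _[_]≔_; here; there)
open import Data.Vec.Properties using (removeAt-punchOut; lookup∘update′; []=⇒lookup; lookup⇒[]=)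
open import Data.List using (List; []; _∷_)
open import Data.List.Relation.Unary.Any using (here; there)
open import Data.List.Membership.Propositional using () renaming (_∈_ to _∈ₗ_)
import Data.List.Membership.DecPropositional as DecMembership
open import Data.Product as Prod using (Σ; ∃; _×_; _,_; proj₁; proj₂; uncurry)
open import Data.Sum as Sum using (_⊎_; inj₁; inj₂)
open import Data.Empty using (⊥-elim)
open import Function.Base using (_∘_; id; _on_)
open import Function.Bundles using (mk↔ₛ′)
open import Function.Definitions using (Injective)
open import Induction.WellFounded using (Acc; acc)
open import Relation.Nullary using (¬_; Dec; yes; no)
open import Relation.Nullary.Decidable using (¬?; _×-dec_; _⊎-dec_)
open import Relation.Unary using (Pred; Decidable; _⊆_)
open import Relation.Binary.PropositionalEquality
open import Relation.Binary.Construct.Closure.ReflexiveTransitive as Star using (Star; ε; _◅_; kleisliStar)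
import Relation.Binary.Construct.On as On

distinct-members : ∀ {n k} (p : Subset n) → k ≤ ∣ p ∣ →
  Σ (Fin k → Fin n) λ f → Injective _≡_ _≡_ f × (∀ i → f i ∈ p)
distinct-members {k = zero} p _ = (λ ()) , (λ { {()} }) , (λ ())
distinct-members (false ∷ p) k≤∣p∣ with distinct-members p k≤∣p∣
... | f , f-inj , f∈p = suc ∘ f , (f-inj ∘ suc-injective) , there ∘ f∈p
distinct-members {k = suc k} (true ∷ p) (s≤s k≤∣p∣) with distinct-members p k≤∣p∣
... | f , f-inj , f∈p = g , g-inj , g∈
  where
  g : Fin (suc k) → Fin _
  g zero    = zero
  g (suc i) = suc (f i)
  g-inj : Injective _≡_ _≡_ g
  g-inj {zero}  {zero}  _  = refl
  g-inj {suc i} {suc j} eq = cong suc (f-inj (suc-injective eq))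
  g∈ : ∀ i → g i ∈ true ∷ p
  g∈ zero    = here
  g∈ (suc i) = there (f∈p i)

missed-value : ∀ {k n} → k < n → (f : Fin k → Fin n) → ∃ λ x → ∀ i → f i ≢ x
missed-value k<n f with all? (λ x → any? (λ i → f i ≟ x))
... | no ¬surjective =
  Prod.map id (λ unhit i fi≡x → unhit (i , fi≡x)) (¬∀⟶∃¬ _ _ (λ x → any? (λ i → f i ≟ x)) ¬surjective)
... | yes surjective = ⊥-elim (<⇒≱ k<n (injective⇒≤ section-injective))
  where
  section-injective : Injective _≡_ _≡_ (proj₁ ∘ surjective)
  section-injective {x} {y} eq =
    trans (sym (proj₂ (surjective x))) (trans (cong f eq) (proj₂ (surjective y)))

∣p∪q∣≤∣p∣+∣q∣ : ∀ {n} (p q : Subset n) → ∣ p ∪ q ∣ ≤ ∣ p ∣ + ∣ q ∣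
∣p∪q∣≤∣p∣+∣q∣ []           []           = z≤n
∣p∪q∣≤∣p∣+∣q∣ (true ∷ p)  (true ∷ q)  =
  s≤s (≤-trans (∣p∪q∣≤∣p∣+∣q∣ p q) (+-monoʳ-≤ ∣ p ∣ (n≤1+n ∣ q ∣)))
∣p∪q∣≤∣p∣+∣q∣ (true ∷ p)  (false ∷ q) = s≤s (∣p∪q∣≤∣p∣+∣q∣ p q)
∣p∪q∣≤∣p∣+∣q∣ (false ∷ p) (true ∷ q)  =
  subst (suc ∣ p ∪ q ∣ ≤_) (sym (+-suc ∣ p ∣ ∣ q ∣)) (s≤s (∣p∪q∣≤∣p∣+∣q∣ p q))
∣p∪q∣≤∣p∣+∣q∣ (false ∷ p) (false ∷ q) = ∣p∪q∣≤∣p∣+∣q∣ p q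

∣⁅a⁆∪⁅b⁆∣≤2 : ∀ {n} (a b : Fin n) → ∣ ⁅ a ⁆ ∪ ⁅ b ⁆ ∣ ≤ 2
∣⁅a⁆∪⁅b⁆∣≤2 a b =
  subst (∣ ⁅ a ⁆ ∪ ⁅ b ⁆ ∣ ≤_) (cong₂ _+_ (∣⁅x⁆∣≡1 a) (∣⁅x⁆∣≡1 b)) (∣p∪q∣≤∣p∣+∣q∣ ⁅ a ⁆ ⁅ b ⁆)

module _ {n : ℕ} where

  Joins : Fin n × Fin n → Fin n → Fin n → Set
  Joins p x y = p ≡ (x , y) ⊎ p ≡ (y , x)

  Inside : Pred (Fin n) _ → Fin n × Fin n → Set
  Inside C (a , b) = C a × C b × a ≢ b

  Pendant : Pred (Fin n) _ → Fin n → Fin n × Fin n → Set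
  Pendant C t p = ∃ λ y → C y × Joins p t y

  Joins-sym : ∀ {p x y} → Joins p x y → Joins p y x
  Joins-sym = Sum.swap

  joins-inside : ∀ {C p x y} → C x → C y → x ≢ y → Joins p x y → Inside C p
  joins-inside cx cy x≢y (inj₁ refl) = cx , cy , x≢y
  joins-inside cx cy x≢y (inj₂ refl) = cy , cx , x≢y ∘ sym

  pendant-mono : ∀ {C D t p} → C ⊆ D → Pendant C t p → Pendant D t p
  pendant-mono C⊆D (y , cy , j) = y , C⊆D cy , j

  pendant-unique : ∀ {C s t p} → ¬ C s → Pendant C s p → Pendant C t p → s ≡ t
  pendant-unique s∉C (_ , _ , inj₁ refl) (_ , _ , inj₁ refl) = refl
  pendant-unique s∉C (_ , _ , inj₁ refl) (_ , cy , inj₂ refl) = ⊥-elim (s∉C cy)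
  pendant-unique s∉C (_ , _ , inj₂ refl) (_ , cy , inj₁ refl) = ⊥-elim (s∉C cy)
  pendant-unique s∉C (_ , _ , inj₂ refl) (_ , _ , inj₂ refl) = refl

  pendant-not-inside : ∀ {C t p} → ¬ C t → Pendant C t p → ¬ Inside C p
  pendant-not-inside t∉C (_ , _ , inj₁ refl) (ct , _) = t∉C ct
  pendant-not-inside t∉C (_ , _ , inj₂ refl) (_ , ct , _) = t∉C ct

Joins-map : ∀ {n m} (f : Fin n → Fin m) {p x y} → Joins p x y → Joins (Prod.map f f p) (f x) (f y)
Joins-map f (inj₁ refl) = inj₁ refl
Joins-map f (inj₂ refl) = inj₂ refl

AdjacentIn : (G : Graft) → Pred (Fin (nV G)) _ → Fin (nV G) → Fin (nV G) → Set
AdjacentIn G C x y = C x × C y × ∃ λ e → Joins (ends G e) x y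

adjacent-mono : ∀ {G C D} → C ⊆ D → ∀ {x y} → AdjacentIn G C x y → AdjacentIn G D x y
adjacent-mono C⊆D (cx , cy , edge) = C⊆D cx , C⊆D cy , edge

walk-image : ∀ {G H C D} (f : Fin (nV G) → Fin (nV H)) → (∀ {x} → C x → D (f x)) →
  (∀ {x y} → AdjacentIn G C x y → f x ≡ f y ⊎ ∃ λ e → Joins (ends H e) (f x) (f y)) →
  ∀ {x y} → Star (AdjacentIn G C) x y → Star (AdjacentIn H D) (f x) (f y)
walk-image {G} {H} {C} {D} f f-centre f-adjacent = kleisliStar f step
  where
  step : ∀ {x y} → AdjacentIn G C x y → Star (AdjacentIn H D) (f x) (f y)
  step adj@(cx , cy , _) with f-adjacent adj
  ... | inj₁ fx≡fy = subst (Star _ _) fx≡fy ε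
  ... | inj₂ edge = (f-centre cx , f-centre cy , edge) ◅ ε

module _ {n : ℕ} {u v : Fin (suc n)} (u≢v : u ≢ v) where

  redirect-fixes : ∀ {x} → x ≢ v → redirect u v x ≡ x
  redirect-fixes {x} x≢v with x ≟ v
  ... | yes x≡v = ⊥-elim (x≢v x≡v)
  ... | no _    = refl

  redirect-preserves : ∀ {ℓ} (P : Pred (Fin (suc n)) ℓ) → P u → ∀ {x} → P x → P (redirect u v x)
  redirect-preserves P pu {x} px with x ≟ v
  ... | yes _ = pu
  ... | no _  = px

  merge-≢ : ∀ {x} (v≢x : v ≢ x) → merge u v u≢v x ≡ punchOut v≢x
  merge-≢ v≢x = punchOut-cong v (redirect-fixes (v≢x ∘ sym))

  punchIn-merge : ∀ x → punchIn v (merge u v u≢v x) ≡ redirect u v x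
  punchIn-merge x = punchIn-punchOut (redirect-≢ u v u≢v x)

  punchIn-merge-≢ : ∀ {x} → x ≢ v → punchIn v (merge u v u≢v x) ≡ x
  punchIn-merge-≢ {x} x≢v = trans (punchIn-merge x) (redirect-fixes x≢v)

  merge-punchIn : ∀ x → merge u v u≢v (punchIn v x) ≡ x
  merge-punchIn x = trans (merge-≢ (punchInᵢ≢i v x ∘ sym)) (punchOut-punchIn v)

  redirect-v : redirect u v v ≡ u
  redirect-v with v ≟ v
  ... | yes _   = refl
  ... | no v≢v = ⊥-elim (v≢v refl)

  merge-v≡merge-u : merge u v u≢v v ≡ merge u v u≢v u
  merge-v≡merge-u = punchOut-cong v (trans redirect-v (sym (redirect-fixes u≢v)))

  merge-joined : ∀ {x y} → Joins (u , v) x y → merge u v u≢v x ≡ merge u v u≢v y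
  merge-joined (inj₁ refl) = sym merge-v≡merge-u
  merge-joined (inj₂ refl) = merge-v≡merge-u

  lookup-removeAt-merge : ∀ {A : Set} (xs : Vec A (suc n)) {x} → x ≢ v →
                          lookup (removeAt xs v) (merge u v u≢v x) ≡ lookup xs x
  lookup-removeAt-merge xs x≢v =
    trans (cong (lookup (removeAt xs v)) (merge-≢ (x≢v ∘ sym))) (removeAt-punchOut xs (x≢v ∘ sym))

  lookup-contractT : ∀ (S : Subset (suc n)) {x} → x ≢ u → x ≢ v →
                     lookup (contractT S u v) (merge u v u≢v x) ≡ lookup S x
  lookup-contractT S {x} x≢u x≢v =
    trans (lookup-removeAt-merge (S [ u ]≔ (lookup S u xor lookup S v)) x≢v)
          (lookup∘update′ x≢u S _)

  deleteVertexEnds-merge : ∀ {m} (ends : Fin m → Fin (suc n) × Fin (suc n)) iso e →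
    deleteVertexEnds ends v iso e ≡ Prod.map (merge u v u≢v) (merge u v u≢v) (ends e)
  deleteVertexEnds-merge ends iso e =
    sym (cong₂ _,_ (merge-≢ (proj₁ (iso e))) (merge-≢ (proj₂ (iso e))))

record ClawModel (G : Graft) : Set₁ where
  field
    leaf           : Fin 3 → Fin (nV G)
    leaf-injective : Injective _≡_ _≡_ leaf
    leaf∈T         : ∀ i → leaf i ∈ T G
    Centre         : Pred (Fin (nV G)) _
    centre?        : Decidable Centre
    leaf∉Centre    : ∀ i → ¬ Centre (leaf i)
    root           : Fin (nV G)
    root∈Centre    : Centre root
    reach          : ∀ {x} → Centre x → Star (AdjacentIn G Centre) root x
    attachment     : Fin 3 → Fin (nE G)
    attaches       : ∀ i → Pendant Centre (leaf i) (ends G (attachment i))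

module _ {G : Graft} (M : ClawModel G) where
  open ClawModel M

  Needed : Fin (nE G) → Set
  Needed e = Inside Centre (ends G e) ⊎ ∃ λ i → attachment i ≡ e

  Claimed : Fin (nV G) → Set
  Claimed x = Centre x ⊎ ∃ λ i → leaf i ≡ x

  inside? : ∀ e → Dec (Inside Centre (ends G e))
  inside? e = centre? _ ×-dec centre? _ ×-dec ¬? (_ ≟ _)

  needed? : Decidable Needed
  needed? e = inside? e ⊎-dec any? (λ i → attachment i ≟ e)

  claimed? : Decidable Claimed
  claimed? x = centre? x ⊎-dec any? (λ i → leaf i ≟ x)

  needed-ends-claimed : ∀ {e} → Needed e → Claimed (proj₁ (ends G e)) × Claimed (proj₂ (ends G e))
  needed-ends-claimed (inj₁ (ca , cb , _)) = inj₁ ca , inj₁ cb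
  needed-ends-claimed (inj₂ (i , refl)) with attaches i
  ... | y , cy , inj₁ eq rewrite eq = inj₂ (i , refl) , inj₁ cy
  ... | y , cy , inj₂ eq rewrite eq = inj₁ cy , inj₂ (i , refl)

  attachment-injective : Injective _≡_ _≡_ attachment
  attachment-injective {i} {j} eq =
    leaf-injective (pendant-unique (leaf∉Centre i) (attaches i)
                                   (subst (Pendant Centre (leaf j) ∘ ends G) (sym eq) (attaches j)))

-- Each graft operation used below acts on vertices through such a projection.
record ModelProjection {G : Graft} (M : ClawModel G) (H : Graft) : Set where
  open ClawModel M
  field
    proj             : Fin (nV G) → Fin (nV H)
    lift             : Fin (nV H) → Fin (nV G)
    proj-lift        : ∀ x → proj (lift x) ≡ x
    lift-proj-centre : ∀ {x} → Centre x → Centre (lift (proj x))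
    lift-proj-leaf   : ∀ i → lift (proj (leaf i)) ≡ leaf i
    proj-terminal    : ∀ i → lookup (T H) (proj (leaf i)) ≡ lookup (T G) (leaf i)
    proj-adjacent    : ∀ {x y} → AdjacentIn G Centre x y →
                       proj x ≡ proj y ⊎ ∃ λ e → Joins (ends H e) (proj x) (proj y)
    proj-attachment  : ∀ i → ∃ λ e → ends H e ≡ Prod.map proj proj (ends G (attachment i))

transport : ∀ {G H} (M : ClawModel G) → ModelProjection M H → ClawModel H
transport {G} {H} M π = record
  { leaf           = proj ∘ leaf
  ; leaf-injective = λ {i} {j} eq →
      leaf-injective (trans (sym (lift-proj-leaf i)) (trans (cong lift eq) (lift-proj-leaf j)))
  ; leaf∈T         = λ i → lookup⇒[]= _ (T H) (trans (proj-terminal i) ([]=⇒lookup (leaf∈T i)))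
  ; Centre         = Centre ∘ lift
  ; centre?        = centre? ∘ lift
  ; leaf∉Centre    = λ i c → leaf∉Centre i (subst Centre (lift-proj-leaf i) c)
  ; root           = proj root
  ; root∈Centre    = lift-proj-centre root∈Centre
  ; reach          = λ {x} c →
      subst (Star (AdjacentIn H (Centre ∘ lift)) (proj root)) (proj-lift x)
                       (walk-image {G} {H} {Centre} {Centre ∘ lift} proj lift-proj-centre proj-adjacent (reach c))
  ; attachment     = proj₁ ∘ proj-attachment
  ; attaches       = attaches′
  }
  where
  open ClawModel M
  open ModelProjection π

  attaches′ : ∀ i → Pendant (Centre ∘ lift) (proj (leaf i)) (ends H (proj₁ (proj-attachment i)))
  attaches′ i with attaches i | proj-attachment i
  ... | y , cy , j | e , eq =
    proj y , lift-proj-centre cy , subst (λ p → Joins p _ _) (sym eq) (Joins-map proj j)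

punchIn-witness : ∀ {m ℓ} (P : Fin (suc m) → Set ℓ) {e e′} → e ≢ e′ → P e′ → ∃ λ k → P (punchIn e k)
punchIn-witness P e≢e′ pe′ = punchOut e≢e′ , subst P (sym (punchIn-punchOut e≢e′)) pe′

edge-deletion : ∀ {n m ends S} (M : ClawModel (graft n (suc m) ends S)) e → ¬ Needed M e →
                ModelProjection M (graft n m (ends ∘ punchIn e) S)
edge-deletion {n} {m} {ends} {S} M e unneeded = record
  { proj = id ; lift = id ; proj-lift = λ _ → refl ; lift-proj-centre = id
  ; lift-proj-leaf = λ _ → refl ; proj-terminal = λ _ → refl
  ; proj-adjacent = adjacent ; proj-attachment = attachment′ }
  where
  open ClawModel M

  adjacent : ∀ {x y} → AdjacentIn (graft n (suc m) ends S) Centre x y →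
             x ≡ y ⊎ ∃ λ e′ → Joins (ends (punchIn e e′)) x y
  adjacent {x} {y} (cx , cy , e′ , j) with e ≟ e′ | x ≟ y
  ... | no e≢e′  | _       = inj₂ (punchIn-witness (λ k → Joins (ends k) x y) e≢e′ j)
  ... | yes _    | yes x≡y = inj₁ x≡y
  ... | yes refl | no x≢y  = ⊥-elim (unneeded (inj₁ (joins-inside cx cy x≢y j)))

  attachment′ : ∀ i → ∃ λ e′ → ends (punchIn e e′) ≡ ends (attachment i)
  attachment′ i with e ≟ attachment i
  ... | yes e≡a = ⊥-elim (unneeded (inj₂ (i , sym e≡a)))
  ... | no e≢a  = punchIn-witness (λ k → ends k ≡ ends (attachment i)) e≢a refl

vertex-deletion : ∀ {n m ends S} (M : ClawModel (graft (suc n) m ends S)) v → ¬ Claimed M v →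
  (isolated : ∀ e → (v ≢ proj₁ (ends e)) × (v ≢ proj₂ (ends e))) →
  ModelProjection M (graft n m (deleteVertexEnds ends v isolated) (removeAt S v))
-- v is isolated, so any total map agreeing with punchOut away from v serves; merge root v is one.
vertex-deletion {ends = ends} {S} M v unclaimed isolated = record
  { proj = merge root v root≢v ; lift = punchIn v ; proj-lift = merge-punchIn root≢v
  ; lift-proj-centre = λ c → subst Centre (sym (punchIn-merge-≢ root≢v (≢v (inj₁ c)))) c
  ; lift-proj-leaf = λ i → punchIn-merge-≢ root≢v (≢v (inj₂ (i , refl)))
  ; proj-terminal = λ i → lookup-removeAt-merge root≢v S (≢v (inj₂ (i , refl)))
  ; proj-adjacent = λ (_ , _ , e , j) →
      inj₂ (e , subst (λ p → Joins p _ _) (sym (deleteVertexEnds-merge root≢v ends isolated e))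
                      (Joins-map _ j))
  ; proj-attachment = λ i → attachment i , deleteVertexEnds-merge root≢v ends isolated (attachment i) }
  where
  open ClawModel M

  ≢v : ∀ {x} → Claimed M x → x ≢ v
  ≢v claimed refl = unclaimed claimed

  root≢v : root ≢ v
  root≢v = ≢v (inj₁ root∈Centre)

inside-contraction : ∀ {n m ends S} (M : ClawModel (graft (suc n) (suc m) ends S)) e →
  (inside : Inside (ClawModel.Centre M) (ends e)) →
  let u = proj₁ (ends e) ; v = proj₂ (ends e) ; u≢v = proj₂ (proj₂ inside) in
  ModelProjection M (graft n m (λ i → mergePair u v u≢v (ends (punchIn e i))) (contractT S u v))
inside-contraction {n} {m} {ends} {S} M e (cu , cv , u≢v) = record
  { proj = merge u v u≢v ; lift = punchIn v ; proj-lift = merge-punchIn u≢v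
  ; lift-proj-centre = λ {x} c →
      subst Centre (sym (punchIn-merge u≢v x)) (redirect-preserves u≢v Centre cu c)
  ; lift-proj-leaf = λ i → punchIn-merge-≢ u≢v (leaf≢ cv i)
  ; proj-terminal = λ i → lookup-contractT u≢v S (leaf≢ cu i) (leaf≢ cv i)
  ; proj-adjacent = adjacent ; proj-attachment = attachment′ }
  where
  open ClawModel M
  u = proj₁ (ends e)
  v = proj₂ (ends e)

  leaf≢ : ∀ {x} → Centre x → ∀ i → leaf i ≢ x
  leaf≢ c i refl = leaf∉Centre i c

  adjacent : ∀ {x y} → AdjacentIn (graft (suc n) (suc m) ends S) Centre x y →
    merge u v u≢v x ≡ merge u v u≢v y ⊎
    ∃ λ e′ → Joins (mergePair u v u≢v (ends (punchIn e e′))) (merge u v u≢v x) (merge u v u≢v y)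
  adjacent {x} {y} (_ , _ , e′ , j) with e ≟ e′
  ... | yes refl = inj₁ (merge-joined u≢v j)
  ... | no e≢e′  =
    inj₂ (punchIn-witness (λ k → Joins (mergePair u v u≢v (ends k)) _ _) e≢e′ (Joins-map _ j))

  attachment′ : ∀ i → ∃ λ e′ →
    mergePair u v u≢v (ends (punchIn e e′)) ≡ mergePair u v u≢v (ends (attachment i))
  attachment′ i with e ≟ attachment i
  ... | yes refl = ⊥-elim (pendant-not-inside (leaf∉Centre i) (attaches i) (cu , cv , u≢v))
  ... | no e≢a   =
    punchIn-witness (λ k → mergePair u v u≢v (ends k) ≡ mergePair u v u≢v (ends (attachment i))) e≢a refl

module ClawShape {G : Graft} (M : ClawModel G)
  (all-needed : ∀ e → Needed M e) (all-claimed : ∀ x → Claimed M x)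
  (nothing-inside : ∀ e → ¬ Inside (ClawModel.Centre M) (ends G e)) where

  open ClawModel M

  adjacent-equal : ∀ {x y} → AdjacentIn G Centre x y → x ≡ y
  adjacent-equal {x} {y} (cx , cy , e , j) with x ≟ y
  ... | yes x≡y = x≡y
  ... | no x≢y  = ⊥-elim (nothing-inside e (joins-inside cx cy x≢y j))

  centre-root : ∀ {x} → Centre x → root ≡ x
  centre-root c = Star.fold _≡_ (trans ∘ adjacent-equal) refl (reach c)

  attachment-of : ∀ e → ∃ λ i → attachment i ≡ e
  attachment-of e with all-needed e
  ... | inj₁ inside   = ⊥-elim (nothing-inside e inside)
  ... | inj₂ attached = attached

  toK : Fin (nV G) → Fin 4
  toK x with all-claimed x
  ... | inj₁ _       = zero
  ... | inj₂ (i , _) = suc i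

  toK-centre : ∀ {x} → Centre x → toK x ≡ zero
  toK-centre {x} c with all-claimed x
  ... | inj₁ _          = refl
  ... | inj₂ (i , refl) = ⊥-elim (leaf∉Centre i c)

  toK-leaf : ∀ i → toK (leaf i) ≡ suc i
  toK-leaf i with all-claimed (leaf i)
  ... | inj₁ c        = ⊥-elim (leaf∉Centre i c)
  ... | inj₂ (j , eq) = cong suc (leaf-injective eq)

  fromK : Fin 4 → Fin (nV G)
  fromK zero    = root
  fromK (suc i) = leaf i

  toK-fromK : ∀ k → toK (fromK k) ≡ k
  toK-fromK zero    = toK-centre root∈Centre
  toK-fromK (suc i) = toK-leaf i

  fromK-toK : ∀ x → fromK (toK x) ≡ x
  fromK-toK x with all-claimed x
  ... | inj₁ c          = centre-root c
  ... | inj₂ (i , refl) = refl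

  ends-pres : ∀ e → Joins (K13ends (proj₁ (attachment-of e))) (toK (proj₁ (ends G e))) (toK (proj₂ (ends G e)))
  ends-pres e with attachment-of e
  ... | i , refl with attaches i
  ...   | y , cy , inj₁ eq rewrite eq | toK-leaf i | toK-centre cy = inj₂ refl
  ...   | y , cy , inj₂ eq rewrite eq | toK-leaf i | toK-centre cy = inj₁ refl

  iso-to-claw : (S : Subset 4) → (root ∈ T G → zero ∈ S) → (zero ∈ S → root ∈ T G) →
                (∀ i → suc i ∈ S) → GraftIso G (graft 4 3 K13ends S)
  iso-to-claw S root⇒zero zero⇒root leaves∈S = record
    { vmap = mk↔ₛ′ toK fromK toK-fromK fromK-toK
    ; emap = mk↔ₛ′ (proj₁ ∘ attachment-of) attachment
               (attachment-injective M ∘ proj₂ ∘ attachment-of ∘ attachment) (proj₂ ∘ attachment-of)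
    ; ends-pres = ends-pres
    ; T-pres = T-pres }
    where
    T-pres : ∀ x → (x ∈ T G → toK x ∈ S) × (toK x ∈ S → x ∈ T G)
    T-pres x with all-claimed x
    ... | inj₂ (i , refl) = (λ _ → leaves∈S i) , (λ _ → leaf∈T i)
    ... | inj₁ c with centre-root c
    ...   | refl = root⇒zero , zero⇒root

  claw-iso : GraftIso G Δ₂ ⊎ GraftIso G Δ₃
  claw-iso with root ∈? T G
  ... | yes root∈T = inj₁ (iso-to-claw ⊤ (λ _ → ∈⊤) (λ _ → root∈T) (λ _ → ∈⊤))
  ... | no  root∉T = inj₂ (iso-to-claw (∁ ⁅ zero ⁆) (⊥-elim ∘ root∉T) (⊥-elim ∘ zero∉) suc∈)
    where
    zero∉ : zero ∉ ∁ ⁅ zero ⁆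
    zero∉ z = x∈∁p⇒x∉p z (x∈⁅x⁆ zero)
    suc∈ : ∀ i → suc i ∈ ∁ ⁅ zero ⁆
    suc∈ i = x∉p⇒x∈∁p (0≢1+n ∘ sym ∘ x∈⁅y⁆⇒x≡y zero)

Reduces : Graft → Set₁
Reduces G = ∃ λ H → Step G H × ClawModel H

unneeded-edge-reduces : ∀ {G} (M : ClawModel G) e → ¬ Needed M e → Reduces G
unneeded-edge-reduces {graft n zero ends S} M () _
unneeded-edge-reduces {graft n (suc m) ends S} M e unneeded =
  _ , deleteEdge ends S e , transport M (edge-deletion M e unneeded)

unclaimed-vertex-reduces : ∀ {G} (M : ClawModel G) → (∀ e → Needed M e) →
                           ∀ v → ¬ Claimed M v → Reduces G
unclaimed-vertex-reduces {graft zero m ends S} M _ () _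
unclaimed-vertex-reduces {graft (suc n) m ends S} M all-needed v unclaimed =
  _ , deleteVertex ends S v isolated , transport M (vertex-deletion M v unclaimed isolated)
  where
  isolated : ∀ e → (v ≢ proj₁ (ends e)) × (v ≢ proj₂ (ends e))
  isolated e = Prod.map (λ claimed v≡ → unclaimed (subst (Claimed M) (sym v≡) claimed))
                        (λ claimed v≡ → unclaimed (subst (Claimed M) (sym v≡) claimed))
                        (needed-ends-claimed M (all-needed e))

inside-edge-reduces : ∀ {G} (M : ClawModel G) e → Inside (ClawModel.Centre M) (ends G e) → Reduces G
inside-edge-reduces {graft n zero ends S} M () _
inside-edge-reduces {graft zero (suc m) ends S} M e _ with proj₁ (ends e)
... | ()
inside-edge-reduces {graft (suc n) (suc m) ends S} M e inside =
  _ , contractEdge ends S e (proj₂ (proj₂ inside)) , transport M (inside-contraction M e inside)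

reduce : ∀ {G} (M : ClawModel G) → Reduces G ⊎ (GraftIso G Δ₂ ⊎ GraftIso G Δ₃)
reduce M with all? (needed? M)
... | no ¬all-needed = inj₁ (uncurry (unneeded-edge-reduces M) (¬∀⟶∃¬ _ _ (needed? M) ¬all-needed))
... | yes all-needed with all? (claimed? M)
...   | no ¬all-claimed =
        inj₁ (uncurry (unclaimed-vertex-reduces M all-needed) (¬∀⟶∃¬ _ _ (claimed? M) ¬all-claimed))
...   | yes all-claimed with any? (inside? M)
...     | yes (e , inside) = inj₁ (inside-edge-reduces M e inside)
...     | no ¬inside =
          inj₂ (ClawShape.claw-iso M all-needed all-claimed (λ e inside → ¬inside (e , inside)))

size : Graft → ℕ
size G = nV G + nE G

step-shrinks : ∀ {G H} → Step G H → size H < size G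
step-shrinks (deleteEdge {n} {m} _ _ _)     = +-monoʳ-< n (n<1+n m)
step-shrinks (deleteVertex {n} {m} _ _ _ _) = +-monoˡ-< m (n<1+n n)
step-shrinks (contractEdge {n} {m} _ _ _ _) = s≤s (+-monoʳ-≤ n (n≤1+n m))

ClawMinor : Graft → Set
ClawMinor G = ∃ λ H → Minor G H × (GraftIso H Δ₂ ⊎ GraftIso H Δ₃)

model⇒claw-minor : ∀ {G} → Acc (_<_ on size) G → ClawModel G → ClawMinor G
model⇒claw-minor {G} (acc smaller) M with reduce M
... | inj₂ iso = G , ε , iso
... | inj₁ (H , step , M′) with model⇒claw-minor (smaller (step-shrinks step)) M′
...   | K , minor , iso = K , step ◅ minor , iso

module _ {n : ℕ} (t : Fin 3 → Fin n) where

  others : Fin 3 → Subset n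
  others i = ⁅ t (punchIn i zero) ⁆ ∪ ⁅ t (punchIn i (suc zero)) ⁆

  ∣others∣<3 : ∀ i → ∣ others i ∣ < 3
  ∣others∣<3 i = s≤s (∣⁅a⁆∪⁅b⁆∣≤2 (t (punchIn i zero)) (t (punchIn i (suc zero))))

  ∉-others : ∀ {i y} → (∀ k → t (punchIn i k) ≢ y) → y ∉ others i
  ∉-others {i} {y} t≢y y∈ with x∈p∪q⁻ _ _ y∈
  ... | inj₁ y∈₀ = t≢y zero (sym (x∈⁅y⁆⇒x≡y _ y∈₀))
  ... | inj₂ y∈₁ = t≢y (suc zero) (sym (x∈⁅y⁆⇒x≡y _ y∈₁))

  -- every j ≢ i is punchIn i k for k : Fin 2
  others-∉ : ∀ {i y} → y ∉ others i → t i ≢ y → ∀ j → t j ≢ y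
  others-∉ {i} {y} y∉ ti≢y j with i ≟ j
  ... | yes refl = ti≢y
  ... | no i≢j   = subst (λ j → t j ≢ y) (punchIn-punchOut i≢j) (other (punchOut i≢j))
    where
    other : ∀ k → t (punchIn i k) ≢ y
    other zero       refl = y∉ (x∈p∪q⁺ (inj₁ (x∈⁅x⁆ _)))
    other (suc zero) refl = y∉ (x∈p∪q⁺ (inj₂ (x∈⁅x⁆ _)))

record Approach (G : Graft) (X : Subset (nV G)) (x c : Fin (nV G)) : Set where
  field
    trail           : List (Fin (nV G))
    start∈trail     : x ∈ₗ trail
    trail-avoids    : ∀ {y} → y ∈ₗ trail → y ∉ X × y ≢ c
    trail-connected : ∀ {y} → y ∈ₗ trail → Star (AdjacentIn G (_∈ₗ trail)) x y
    trail-touches   : ∃ λ e → Pendant (_∈ₗ trail) c (ends G e)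

approach : ∀ {G X x c} → Star (AdjOutside G X) x c → x ≢ c → Approach G X x c
approach ε x≢c = ⊥-elim (x≢c refl)
approach {G} {X} {x} {c} (_◅_ {j = x′} (x∉X , _ , e , j) walk) x≢c with x′ ≟ c
... | yes refl = record
  { trail = x ∷ []
  ; start∈trail = here refl
  ; trail-avoids = λ { (here refl) → x∉X , x≢c }
  ; trail-connected = λ { (here refl) → ε }
  ; trail-touches = e , x , here refl , Joins-sym j }
... | no x′≢c = record
  { trail = x ∷ trail
  ; start∈trail = here refl
  ; trail-avoids = λ { (here refl) → x∉X , x≢c ; (there y∈) → trail-avoids y∈ }
  ; trail-connected = λ
      { (here refl) → ε
      ; (there y∈) →
          (here refl , there start∈trail , e , j) ◅ Star.map (adjacent-mono {G} there) (trail-connected y∈) }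
  ; trail-touches = Prod.map id (pendant-mono there) trail-touches }
  where open Approach (approach {G} {X} walk x′≢c)

three-connected-model : ∀ {G} → ThreeConnected G → 3 ≤ ∣ T G ∣ → ClawModel G
three-connected-model {G} (3<n , connected) 3≤∣T∣ = record
  { leaf = t ; leaf-injective = t-injective ; leaf∈T = t∈T
  ; Centre = Centre ; centre? = centre?
  ; leaf∉Centre = λ j (i , y∈) → let y∉others , y≢ti = trail-avoids (A i) y∈ in
                                 others-∉ t y∉others (y≢ti ∘ sym) j refl
  ; root = w ; root∈Centre = zero , start∈trail (A zero)
  ; reach = λ (i , y∈) → Star.map (adjacent-mono {G} (i ,_)) (trail-connected (A i) y∈)
  ; attachment = proj₁ ∘ touch ; attaches = proj₂ ∘ touch }
  where
  open Approach

  t : Fin 3 → Fin (nV G)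
  t = proj₁ (distinct-members (T G) 3≤∣T∣)

  t-injective : Injective _≡_ _≡_ t
  t-injective = proj₁ (proj₂ (distinct-members (T G) 3≤∣T∣))

  t∈T : ∀ i → t i ∈ T G
  t∈T = proj₂ (proj₂ (distinct-members (T G) 3≤∣T∣))

  w : Fin (nV G)
  w = proj₁ (missed-value 3<n t)

  t≢w : ∀ i → t i ≢ w
  t≢w = proj₂ (missed-value 3<n t)

  A : ∀ i → Approach G (others t i) w (t i)
  A i = approach (connected (others t i) (∣others∣<3 t i) w (t i) w∉ ti∉) (t≢w i ∘ sym)
    where
    w∉ : w ∉ others t i
    w∉ = ∉-others t (λ k → t≢w (punchIn i k))
    ti∉ : t i ∉ others t i
    ti∉ = ∉-others t (λ k → punchInᵢ≢i i k ∘ t-injective)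

  Centre : Fin (nV G) → Set
  Centre y = ∃ λ i → y ∈ₗ trail (A i)

  centre? : Decidable Centre
  centre? y = any? (λ i → DecMembership._∈?_ _≟_ y (trail (A i)))

  touch : ∀ i → ∃ λ e → Pendant Centre (t i) (ends G e)
  touch i = Prod.map id (pendant-mono (i ,_)) (trail-touches (A i))

lemma3p7 : (G : Graft) → ThreeConnected G → 3 ≤ ∣ T G ∣ →
    ∃ λ H → Minor G H × (GraftIso H Δ₂ ⊎ GraftIso H Δ₃)
lemma3p7 G 3-connected 3≤∣T∣ =
  model⇒claw-minor (On.wellFounded size <-wellFounded G) (three-connected-model 3-connected 3≤∣T∣)
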